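{- Let $G$ be a graph with $n$ vertices and let $k$ be a nonnegative integer. Construct the graph $G'$ with vertex set $V(G')=V(G)\cup\{a_v,b_v,c_v,x_v,y_v : v\in V(G)\}$ (all new vertices distinct) and edge set $E(G')=E(G)\cup\{va_v,\ a_vb_v,\ b_vc_v,\ b_vx_v,\ c_vy_v : v\in V(G)\}$. Then $G$ has a dominating set of cardinality at most $k$ if and only if $G'$ has a neighborhood total dominating set of cardinality at most $k+2n$.
   Context: For a graph $G=(V,E)$ and $v\in V$, $N_G(v)=\{u\in V: uv\in E\}$ and for $S\subseteq V$, $N_G(S)=\bigcup_{u\in S}N_G(u)$. A set $D\subseteq V$ is a dominating set if every vertex of $V\setminus D$ is adjacent to some vertex of $D$. A neighborhood total dominating set (NTD-set) of $G$ is a dominating set $D$ of $G$ such that the subgraph of $G$ induced by $N_G(D)$ has no isolated vertex. -}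

module Defs where

open import Data.Nat using (ℕ; _≤_; _+_; _*_)
open import Data.Fin using (Fin)
open import Data.List using (List; length)
open import Data.List.Membership.Propositional using (_∈_)
open import Data.List.Relation.Unary.Unique.Propositional using (Unique)
open import Data.Product using (Σ; ∃; _×_; _,_)
open import Data.Sum using (_⊎_; inj₁; inj₂)
open import Data.Empty using (⊥)
open import Relation.Nullary using (¬_)

record Graph (V : Set) : Set₁ where
  field
    Adj    : V → V → Set
    sym    : ∀ {u v} → Adj u v → Adj v u
    irrefl : ∀ {v} → ¬ Adj v v
open Graph public

-- Finite vertex sets are represented as duplicate-free lists; cardinality = length.

InN : ∀ {V} → Graph V → List V → V → Set
InN G S u = ∃ λ v → v ∈ S × Adj G v u

IsDominating : ∀ {V} → Graph V → List V → Set
IsDominating G D = ∀ v → v ∈ D ⊎ ∃ λ u → u ∈ D × Adj G u v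

-- NTD-set: dominating, and the subgraph induced by N_G(D) has no isolated vertex.
IsNTD : ∀ {V} → Graph V → List V → Set
IsNTD G D = IsDominating G D ×
  (∀ u → InN G D u → ∃ λ w → InN G D w × Adj G u w)

HasDomSetAtMost : ∀ {V} → Graph V → ℕ → Set
HasDomSetAtMost {V} G k = ∃ λ (D : List V) → Unique D × length D ≤ k × IsDominating G D

HasNTDSetAtMost : ∀ {V} → Graph V → ℕ → Set
HasNTDSetAtMost {V} G k = ∃ λ (D : List V) → Unique D × length D ≤ k × IsNTD G D

data V' (n : ℕ) : Set where
  orig : Fin n → V' n
  a b c x y : Fin n → V' n

module _ {n : ℕ} (G : Graph (Fin n)) where
  -- one orientation of each edge of G'
  data Edge' : V' n → V' n → Set where
    old : ∀ {u v} → Adj G u v → Edge' (orig u) (orig v)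
    va  : ∀ v → Edge' (orig v) (a v)
    ab  : ∀ v → Edge' (a v) (b v)
    bc  : ∀ v → Edge' (b v) (c v)
    bx  : ∀ v → Edge' (b v) (x v)
    cy  : ∀ v → Edge' (c v) (y v)

  Adj' : V' n → V' n → Set
  Adj' u v = Edge' u v ⊎ Edge' v u

  private
    edge-irrefl : ∀ {v} → ¬ Edge' v v
    edge-irrefl (old e) = irrefl G e

  G' : Graph (V' n)
  G' = record
    { Adj = Adj'
    ; sym = λ { (inj₁ e) → inj₂ e ; (inj₂ e) → inj₁ e }
    ; irrefl = λ { (inj₁ e) → edge-irrefl e ; (inj₂ e) → edge-irrefl e }
    }

module Submission where

-- Forward: D ∪ {b_v, c_v : v ∈ V} dominates G'; as b_v ~ c_v, all b_v and c_v lie in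
-- N(D'), and every vertex of G' is adjacent to one of them.
-- Backward: group V(G') into the 3n slots {v, a_v}, {b_v, x_v}, {c_v, y_v}. To dominate
-- x_v and y_v, a dominating set D' of G' meets every slot {b_v, x_v} and {c_v, y_v}; as a_v
-- is the only new neighbour of v, the v whose slot {v, a_v} meets D' dominate G. Counting
-- the slots that D' meets gives |D| + 2n ≤ |D'|.

open import Defs hiding (sym)
open import Data.Nat using (ℕ; _+_; _*_; _≤_; z≤n; s≤s; suc)
open import Data.Nat.Properties using (≤-trans; ≤-reflexive; +-cancelʳ-≤; +-monoˡ-≤; +-identityʳ; module ≤-Reasoning)
open import Data.Fin using (Fin; zero; suc; _≟_)
open import Data.List using (List; []; _∷_; map; _++_; length; filter; allFin)
open import Data.List.Properties using (length-map; length-++; length-tabulate; length-removeAt′)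
open import Data.List.Membership.Propositional using (_∈_; _─_)
open import Data.List.Membership.Propositional.Properties
  using (∈-map⁺; ∈-map⁻; ∈-++⁺ˡ; ∈-++⁺ʳ; ∈-++⁻; ∈-filter⁺; ∈-filter⁻; ∈-allFin)
open import Data.List.Relation.Unary.Any using (here; there; index)
import Data.List.Relation.Unary.All as All
open import Data.List.Relation.Unary.AllPairs using (_∷_)
open import Data.List.Relation.Unary.Unique.Propositional using (Unique)
import Data.List.Relation.Unary.Unique.Propositional.Properties as Unique
open import Data.List.Relation.Binary.Disjoint.Propositional using (Disjoint)
open import Data.List.Relation.Binary.Subset.Propositional using (_⊆_)
open import Data.Product using (∃; _×_; _,_; proj₁; proj₂)
open import Data.Product.Properties using (≡-dec)
open import Data.Sum using (inj₁; inj₂; [_,_]′)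
open import Data.Empty using (⊥-elim)
open import Function.Bundles using (_⇔_; mk⇔)
open import Relation.Nullary using (Dec)
open import Relation.Binary.PropositionalEquality using (_≡_; _≢_; refl; sym; trans; cong; cong₂; subst; module ≡-Reasoning)

module _ {a} {A : Set a} where

  ∈-─⁺ : ∀ {v w} {ys : List A} (w∈ys : w ∈ ys) → v ∈ ys → w ≢ v → v ∈ ys ─ w∈ys
  ∈-─⁺ (here refl)  (here refl)  w≢v = ⊥-elim (w≢v refl)
  ∈-─⁺ (here _)     (there v∈ys) _   = v∈ys
  ∈-─⁺ (there _)    (here refl)  _   = here refl
  ∈-─⁺ (there w∈ys) (there v∈ys) w≢v = there (∈-─⁺ w∈ys v∈ys w≢v)

  Unique∧⊆⇒length≤ : ∀ {xs ys : List A} → Unique xs → xs ⊆ ys → length xs ≤ length ys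
  Unique∧⊆⇒length≤ {[]} _ _ = z≤n
  Unique∧⊆⇒length≤ {z ∷ zs} {ys} (z∉zs ∷ zs!) z∷zs⊆ys = begin
    suc (length zs)          ≤⟨ s≤s (Unique∧⊆⇒length≤ zs! zs⊆ys─z) ⟩
    suc (length (ys ─ z∈ys)) ≡⟨ sym (length-removeAt′ ys (index z∈ys)) ⟩
    length ys                ∎
    where
    open ≤-Reasoning
    z∈ys = z∷zs⊆ys (here refl)
    zs⊆ys─z : zs ⊆ ys ─ z∈ys
    zs⊆ys─z w∈zs = ∈-─⁺ z∈ys (z∷zs⊆ys (there w∈zs)) (All.lookup z∉zs w∈zs)

module _ {a b} {A : Set a} {B : Set b} where

  proj₁-∈-map-, : ∀ {i} {p : A × B} {xs : List B} → p ∈ map (i ,_) xs → proj₁ p ≡ i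
  proj₁-∈-map-, {i} p∈ with ∈-map⁻ (i ,_) p∈
  ... | _ , _ , refl = refl

  map-,-disjoint : ∀ {i j} → i ≢ j → {xs ys : List B} → Disjoint (map (i ,_) xs) (map (j ,_) ys)
  map-,-disjoint i≢j (p∈xs , p∈ys) = i≢j (trans (sym (proj₁-∈-map-, p∈xs)) (proj₁-∈-map-, p∈ys))

module _ {n : ℕ} where

  Slot : Set
  Slot = Fin 3 × Fin n

  slot : V' n → Slot
  slot (orig v) = zero , v
  slot (a v)    = zero , v
  slot (b v)    = suc zero , v
  slot (x v)    = suc zero , v
  slot (c v)    = suc (suc zero) , v
  slot (y v)    = suc (suc zero) , v

  embed : Slot → V' n
  embed (zero , v)           = orig v
  embed (suc zero , v)       = b v
  embed (suc (suc zero) , v) = c v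

  slot-embed : ∀ s → slot (embed s) ≡ s
  slot-embed (zero , v)           = refl
  slot-embed (suc zero , v)       = refl
  slot-embed (suc (suc zero) , v) = refl

  embed-injective : ∀ {s t} → embed s ≡ embed t → s ≡ t
  embed-injective {s} {t} e = trans (sym (slot-embed s)) (trans (cong slot e) (slot-embed t))

  root-slots : List (Fin n) → List Slot
  root-slots = map (zero ,_)

  bx-slots cy-slots : List Slot
  bx-slots = map (suc zero ,_) (allFin n)
  cy-slots = map (suc (suc zero) ,_) (allFin n)

  layered : List (Fin n) → List Slot
  layered D = root-slots D ++ (bx-slots ++ cy-slots)

  layered-unique : ∀ {D} → Unique D → Unique (layered D)
  layered-unique {D} D! =
    Unique.++⁺ (Unique.map⁺ (cong proj₂) D!)
      (Unique.++⁺ (Unique.map⁺ (cong proj₂) allFin!) (Unique.map⁺ (cong proj₂) allFin!) (map-,-disjoint λ ()))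
      roots-disjoint
    where
    allFin! : Unique (allFin n)
    allFin! = Unique.allFin⁺ n
    roots-disjoint : Disjoint (root-slots D) (bx-slots ++ cy-slots)
    roots-disjoint (p∈D , p∈bc) =
      [ (λ p∈bx → map-,-disjoint (λ ()) (p∈D , p∈bx))
      , (λ p∈cy → map-,-disjoint (λ ()) (p∈D , p∈cy)) ]′ (∈-++⁻ bx-slots p∈bc)

  length-layered : ∀ D → length (layered D) ≡ length D + 2 * n
  length-layered D = begin
    length (layered D)                                       ≡⟨ length-++ (root-slots D) ⟩
    length (root-slots D) + length (bx-slots ++ cy-slots)    ≡⟨ cong₂ _+_ (length-map _ D) (length-++ bx-slots) ⟩
    length D + (length bx-slots + length cy-slots)           ≡⟨ cong (length D +_) (cong₂ _+_ (|allFin| (suc zero)) (|allFin| (suc (suc zero)))) ⟩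
    length D + (n + n)                                       ≡⟨ cong (λ m → length D + (n + m)) (sym (+-identityʳ n)) ⟩
    length D + 2 * n                                         ∎
    where
    open ≡-Reasoning
    |allFin| : ∀ (i : Fin 3) → length (map (i ,_) (allFin n)) ≡ n
    |allFin| i = trans (length-map (i ,_) (allFin n)) (length-tabulate (λ v → v))

  layered-⊆ : ∀ {D} {S : List Slot} → (∀ {v} → v ∈ D → (zero , v) ∈ S) →
              (∀ v → (suc zero , v) ∈ S) → (∀ v → (suc (suc zero) , v) ∈ S) → layered D ⊆ S
  layered-⊆ {D} root∈ bx∈ cy∈ s∈ with ∈-++⁻ (root-slots D) s∈
  ... | inj₁ s∈₀ with ∈-map⁻ _ s∈₀
  ...   | v , v∈D , refl = root∈ v∈D
  layered-⊆ root∈ bx∈ cy∈ s∈ | inj₂ s∈₁₂ with ∈-++⁻ bx-slots s∈₁₂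
  ... | inj₁ s∈₁ with ∈-map⁻ _ s∈₁
  ...   | v , _ , refl = bx∈ v
  layered-⊆ root∈ bx∈ cy∈ s∈ | inj₂ s∈₁₂ | inj₂ s∈₂ with ∈-map⁻ _ s∈₂
  ...   | v , _ , refl = cy∈ v

  lift : List (Fin n) → List (V' n)
  lift D = map embed (layered D)

  orig∈lift : ∀ {D v} → v ∈ D → orig v ∈ lift D
  orig∈lift v∈D = ∈-map⁺ embed (∈-++⁺ˡ (∈-map⁺ _ v∈D))

  b∈lift : ∀ D v → b v ∈ lift D
  b∈lift D v = ∈-map⁺ embed (∈-++⁺ʳ (root-slots D) (∈-++⁺ˡ (∈-map⁺ _ (∈-allFin v))))

  c∈lift : ∀ D v → c v ∈ lift D
  c∈lift D v = ∈-map⁺ embed (∈-++⁺ʳ (root-slots D) (∈-++⁺ʳ bx-slots (∈-map⁺ _ (∈-allFin v))))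

  lift-unique : ∀ {D} → Unique D → Unique (lift D)
  lift-unique D! = Unique.map⁺ embed-injective (layered-unique D!)

  length-lift : ∀ D → length (lift D) ≡ length D + 2 * n
  length-lift D = trans (length-map embed (layered D)) (length-layered D)

  open import Data.List.Membership.DecPropositional (≡-dec (_≟_ {3}) (_≟_ {n})) using (_∈?_)

  root? : ∀ D' v → Dec ((zero , v) ∈ map slot D')
  root? D' v = (zero , v) ∈? map slot D'

  roots : List (V' n) → List (Fin n)
  roots D' = filter (root? D') (allFin n)

  roots-unique : ∀ D' → Unique (roots D')
  roots-unique D' = Unique.filter⁺ (root? D') (Unique.allFin⁺ n)

  ∈-roots⁺ : ∀ D' {u v} → u ∈ D' → slot u ≡ (zero , v) → v ∈ roots D'
  ∈-roots⁺ D' {v = v} u∈D' u↦v =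
    ∈-filter⁺ (root? D') (∈-allFin v) (subst (_∈ map slot D') u↦v (∈-map⁺ slot u∈D'))

  ∈-roots⁻ : ∀ D' {v} → v ∈ roots D' → (zero , v) ∈ map slot D'
  ∈-roots⁻ D' v∈ = proj₂ (∈-filter⁻ (root? D') {xs = allFin n} v∈)

module _ {n : ℕ} (G : Graph (Fin n)) where

  lift-dominating : ∀ {D} → IsDominating G D → IsDominating (G' G) (lift D)
  lift-dominating D-dom (orig v) with D-dom v
  ... | inj₁ v∈D            = inj₁ (orig∈lift v∈D)
  ... | inj₂ (u , u∈D , uv) = inj₂ (orig u , orig∈lift u∈D , inj₁ (old uv))
  lift-dominating {D} _ (a v) = inj₂ (b v , b∈lift D v , inj₂ (ab v))
  lift-dominating {D} _ (b v) = inj₁ (b∈lift D v)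
  lift-dominating {D} _ (c v) = inj₁ (c∈lift D v)
  lift-dominating {D} _ (x v) = inj₂ (b v , b∈lift D v , inj₁ (bx v))
  lift-dominating {D} _ (y v) = inj₂ (c v , c∈lift D v , inj₁ (cy v))

  neighbour-in-N : ∀ {D'} → (∀ v → b v ∈ D' × c v ∈ D') →
                   ∀ u → ∃ λ w → InN (G' G) D' w × Adj (G' G) u w
  neighbour-in-N bc∈ (orig v) = a v , (b v , proj₁ (bc∈ v) , inj₂ (ab v)) , inj₁ (va v)
  neighbour-in-N bc∈ (a v)    = b v , (c v , proj₂ (bc∈ v) , inj₂ (bc v)) , inj₁ (ab v)
  neighbour-in-N bc∈ (b v)    = c v , (b v , proj₁ (bc∈ v) , inj₁ (bc v)) , inj₁ (bc v)
  neighbour-in-N bc∈ (c v)    = b v , (c v , proj₂ (bc∈ v) , inj₂ (bc v)) , inj₂ (bc v)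
  neighbour-in-N bc∈ (x v)    = b v , (c v , proj₂ (bc∈ v) , inj₂ (bc v)) , inj₂ (bx v)
  neighbour-in-N bc∈ (y v)    = c v , (b v , proj₁ (bc∈ v) , inj₁ (bc v)) , inj₂ (cy v)

  lift-NTD : ∀ {D} → IsDominating G D → IsNTD (G' G) (lift D)
  lift-NTD {D} D-dom = lift-dominating D-dom , λ u _ → neighbour-in-N (λ v → b∈lift D v , c∈lift D v) u

  roots-dominating : ∀ {D'} → IsDominating (G' G) D' → IsDominating G (roots D')
  roots-dominating {D'} D'-dom v with D'-dom (orig v)
  ... | inj₁ v∈D'                               = inj₁ (∈-roots⁺ D' v∈D' refl)
  ... | inj₂ (orig w , w∈D' , inj₁ (old wv))    = inj₂ (w , ∈-roots⁺ D' w∈D' refl , wv)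
  ... | inj₂ (orig w , w∈D' , inj₂ (old vw))    = inj₂ (w , ∈-roots⁺ D' w∈D' refl , Graph.sym G vw)
  ... | inj₂ (.(a v) , av∈D' , inj₂ (va .v))    = inj₁ (∈-roots⁺ D' av∈D' refl)

  layered-roots-⊆ : ∀ {D'} → IsDominating (G' G) D' → layered (roots D') ⊆ map slot D'
  layered-roots-⊆ {D'} D'-dom = layered-⊆ (∈-roots⁻ D') bx∈ cy∈
    where
    bx∈ : ∀ v → (suc zero , v) ∈ map slot D'
    bx∈ v with D'-dom (x v)
    ... | inj₁ xv∈D'                          = ∈-map⁺ slot xv∈D'
    ... | inj₂ (.(b v) , bv∈D' , inj₁ (bx .v)) = ∈-map⁺ slot bv∈D'
    cy∈ : ∀ v → (suc (suc zero) , v) ∈ map slot D'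
    cy∈ v with D'-dom (y v)
    ... | inj₁ yv∈D'                          = ∈-map⁺ slot yv∈D'
    ... | inj₂ (.(c v) , cv∈D' , inj₁ (cy .v)) = ∈-map⁺ slot cv∈D'

  length-roots : ∀ {D'} → IsDominating (G' G) D' → length (roots D') + 2 * n ≤ length D'
  length-roots {D'} D'-dom = begin
    length (roots D') + 2 * n    ≡⟨ sym (length-layered (roots D')) ⟩
    length (layered (roots D'))  ≤⟨ Unique∧⊆⇒length≤ (layered-unique (roots-unique D')) (layered-roots-⊆ D'-dom) ⟩
    length (map slot D')         ≡⟨ length-map slot D' ⟩
    length D'                    ∎
    where open ≤-Reasoning

lemma8 : (n : ℕ) (G : Graph (Fin n)) (k : ℕ) →
    HasDomSetAtMost G k ⇔ HasNTDSetAtMost (G' G) (k + 2 * n)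
lemma8 n G k = mk⇔ from-dominating to-dominating
  where
  from-dominating : HasDomSetAtMost G k → HasNTDSetAtMost (G' G) (k + 2 * n)
  from-dominating (D , D! , |D|≤k , D-dom) =
    lift D , lift-unique D! ,
    ≤-trans (≤-reflexive (length-lift D)) (+-monoˡ-≤ (2 * n) |D|≤k) ,
    lift-NTD G D-dom

  to-dominating : HasNTDSetAtMost (G' G) (k + 2 * n) → HasDomSetAtMost G k
  to-dominating (D' , _ , |D'|≤k+2n , D'-dom , _) =
    roots D' , roots-unique D' ,
    +-cancelʳ-≤ (2 * n) _ k (≤-trans (length-roots G D'-dom) |D'|≤k+2n) ,
    roots-dominating G D'-dom
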